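{- Let $V=\{1,\ldots,v\}$, $t\ge 0$, and let $\{T_0,T_1\}$ be a $[t]$-trade over $V$. Let $\{\hat T_0,\hat T_1\}$ be obtained by replacing every block $(x_1,\ldots,x_v)$ by the $2v$-tuple $(x_1,\ldots,x_v,x_1+1,\ldots,x_v+1)$ (addition modulo $2$), viewed as a subset of $\{1,\ldots,2v\}$. Then every block of $\{\hat T_0,\hat T_1\}$ has exactly $v$ elements and $\{\hat T_0,\hat T_1\}$ is a $[t]$-trade over $\{1,\ldots,2v\}$; that is, it is a $t$-$(2v,v)$ trade.
   Context: Subsets of $\{1,\ldots,n\}$ are identified with their characteristic vectors in $\{0,1\}^n$. A $[t]$-trade over $\{1,\ldots,n\}$ is a pair $\{T_0,T_1\}$ of disjoint collections of subsets of $\{1,\ldots,n\}$ (blocks) such that for every $j\in\{0,\ldots,t\}$ and every $j$-element subset $s$, the number of blocks of $T_0$ containing $s$ equals the number of blocks of $T_1$ containing $s$. A $t$-$(n,k)$ trade is a $[t]$-trade over $\{1,\ldots,n\}$ all of whose blocks have exactly $k$ elements. -}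

module Defs where

open import Data.Nat using (ℕ; _≤_; _+_)
open import Data.Bool using (Bool; not)
open import Data.Vec using (Vec; _++_; map)
open import Data.List using (List; length; filter)
import Data.List as List
open import Data.Product using (_×_)
open import Data.Fin.Subset using (Subset; _⊆_; ∣_∣)
open import Data.Fin.Subset.Properties using (_⊆?_)
open import Data.List.Relation.Binary.Disjoint.Propositional using (Disjoint)
open import Relation.Binary.PropositionalEquality using (_≡_)
open import Data.List.Membership.Propositional using (_∈_)

-- A block is a subset of {1..n}, represented by its characteristic vector.
-- A collection of blocks is a list (multiset) of blocks.

count : {n : ℕ} → List (Subset n) → Subset n → ℕ
count T s = length (filter (s ⊆?_) T)

IsTrade : (t n : ℕ) → List (Subset n) → List (Subset n) → Set
IsTrade t n T₀ T₁ =
  Disjoint T₀ T₁ ×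
  ((s : Subset n) → ∣ s ∣ ≤ t → count T₀ s ≡ count T₁ s)

Uniform : {n : ℕ} → ℕ → List (Subset n) → Set
Uniform k T = ∀ {b} → b ∈ T → ∣ b ∣ ≡ k

-- (x₁..x_v) ↦ (x₁..x_v, x₁+1..x_v+1) mod 2
hat : {v : ℕ} → Subset v → Subset (v + v)
hat x = x ++ map not x

hatColl : {v : ℕ} → List (Subset v) → List (Subset (v + v))
hatColl = List.map hat

module Submission where

-- The block x ⊆ {1..v} becomes hat x = x ++ ∁ x ⊆ {1..2v}, which has ∣ x ∣ + (v - ∣ x ∣) = v
-- elements; hat is injective, so disjointness is preserved.  For balance, write a subset of
-- {1..2v} as a ++ b with a, b ⊆ {1..v}: then a ++ b ⊆ hat x iff a ⊆ x and b ∩ x = ∅.  So it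
-- suffices that the two collections agree on the generalized count
--   #{ x ∈ T : a ⊆ x, b ∩ x = ∅ }   whenever ∣ a ∣ + ∣ b ∣ ≤ t.
-- This is inclusion–exclusion, organised as a deletion–contraction induction on ∣ b ∣: for
-- i ∈ b, the blocks avoiding b - i split into those avoiding b and those that contain i, so
--   #(a, b - i) = #(a, b) + #(a ∪ {i}, b - i),
-- and both counts on the outside involve strictly smaller forbidden sets with total size
-- still at most t; when b = ∅ the generalized count is the ordinary trade count.

open import Defs
open import Data.Nat using (ℕ; suc; _+_; _≤_; _<_; z≤n; s≤s; s≤s⁻¹)
open import Data.Nat.Properties
  using (+-identityʳ; +-suc; +-assoc; +-cancelʳ-≡; +-monoʳ-≤; +-monoˡ-≤; ≤-refl; ≤-trans; <⇒≤;
         <-≤-trans; m+n≤o⇒m≤o; m+[n∸m]≡n; +-commutativeSemigroup; module ≤-Reasoning)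
open import Algebra.Properties.CommutativeSemigroup +-commutativeSemigroup using (interchange)
open import Data.Bool using (Bool; true; false; not; _∧_; _∨_)
open import Data.Bool.Properties using (∧-zeroʳ; ∨-identityʳ)
open import Data.Product using (_×_; _,_)
open import Data.Fin using (Fin)
open import Data.Vec using ([]; _∷_; _++_; here; there; splitAt)
open import Data.Vec.Properties using (++-injectiveˡ)
open import Data.Fin.Subset using (Subset; ∣_∣; ⊥; ⁅_⁆; ∁; _∪_; _-_; _∈_)
open import Data.Fin.Subset.Properties
  using (_⊆?_; Empty-unique; nonempty?; x∈p⇒∣p-x∣<∣p∣; p─⊥≡p; ∣p∣≤∣x∷p∣; ∪-identityʳ; ∣⁅x⁆∣≡1;
         ∣p∣≤n; ∣∁p∣≡n∸∣p∣)
open import Data.List using (List; []; _∷_)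
import Data.List as List
open import Data.List.Membership.Propositional.Properties using (∈-map⁻)
open import Data.List.Relation.Binary.Disjoint.Propositional using (Disjoint)
open import Relation.Nullary using (does; yes; no)
open import Relation.Binary.PropositionalEquality
  using (_≡_; refl; sym; trans; cong; cong₂; subst; module ≡-Reasoning)

indicator : Bool → ℕ
indicator true  = 1
indicator false = 0

countBy : {n : ℕ} → (Subset n → Bool) → List (Subset n) → ℕ
countBy f []      = 0
countBy f (x ∷ T) = indicator (f x) + countBy f T

countBy-ext : {n : ℕ} {f g : Subset n → Bool} → (∀ x → f x ≡ g x) →
  (T : List (Subset n)) → countBy f T ≡ countBy g T
countBy-ext f≡g []      = refl
countBy-ext f≡g (x ∷ T) = cong₂ _+_ (cong indicator (f≡g x)) (countBy-ext f≡g T)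

countBy-map : {n m : ℕ} (f : Subset m → Bool) (h : Subset n → Subset m) (T : List (Subset n)) →
  countBy f (List.map h T) ≡ countBy (λ x → f (h x)) T
countBy-map f h []      = refl
countBy-map f h (x ∷ T) = cong (indicator (f (h x)) +_) (countBy-map f h T)

count≡countBy : {n : ℕ} (T : List (Subset n)) (s : Subset n) →
  count T s ≡ countBy (λ x → does (s ⊆? x)) T
count≡countBy []      s = refl
count≡countBy (x ∷ T) s with does (s ⊆? x)
... | true  = cong suc (count≡countBy T s)
... | false = count≡countBy T s

countBy-additive : {n : ℕ} {f g h : Subset n → Bool} →
  (∀ x → indicator (f x) ≡ indicator (g x) + indicator (h x)) →
  (T : List (Subset n)) → countBy f T ≡ countBy g T + countBy h T
countBy-additive split []      = refl
countBy-additive {f = f} {g} {h} split (x ∷ T) = begin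
  indicator (f x) + countBy f T
    ≡⟨ cong₂ _+_ (split x) (countBy-additive split T) ⟩
  (indicator (g x) + indicator (h x)) + (countBy g T + countBy h T)
    ≡⟨ interchange (indicator (g x)) (indicator (h x)) (countBy g T) (countBy h T) ⟩
  (indicator (g x) + countBy g T) + (indicator (h x) + countBy h T) ∎
  where open ≡-Reasoning

-- fits a b x holds iff a ⊆ x and b ∩ x = ∅, tested coordinatewise: a coordinate ξ of x
-- is admissible if it is 1 where a is required (α) and 0 where b is forbidden (β).
admits : Bool → Bool → Bool → Bool
admits α β true  = not β
admits α β false = not α

fits : {n : ℕ} → Subset n → Subset n → Subset n → Bool
fits []      []      []      = true
fits (α ∷ a) (β ∷ b) (ξ ∷ x) = admits α β ξ ∧ fits a b x

⊆?-++ : {n k : ℕ} (a x : Subset n) (b y : Subset k) →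
  does ((a ++ b) ⊆? (x ++ y)) ≡ does (a ⊆? x) ∧ does (b ⊆? y)
⊆?-++ []          []          b y = refl
⊆?-++ (false ∷ a) (_ ∷ x)     b y = ⊆?-++ a x b y
⊆?-++ (true ∷ a)  (false ∷ x) b y = refl
⊆?-++ (true ∷ a)  (true ∷ x)  b y = ⊆?-++ a x b y

⊆?-∁ : {n : ℕ} (a b x : Subset n) → does (a ⊆? x) ∧ does (b ⊆? ∁ x) ≡ fits a b x
⊆?-∁ []          []          []          = refl
⊆?-∁ (false ∷ a) (false ∷ b) (true ∷ x)  = ⊆?-∁ a b x
⊆?-∁ (true ∷ a)  (false ∷ b) (true ∷ x)  = ⊆?-∁ a b x
⊆?-∁ (false ∷ a) (true ∷ b)  (true ∷ x)  = ∧-zeroʳ (does (a ⊆? x))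
⊆?-∁ (true ∷ a)  (true ∷ b)  (true ∷ x)  = ∧-zeroʳ (does (a ⊆? x))
⊆?-∁ (false ∷ a) (false ∷ b) (false ∷ x) = ⊆?-∁ a b x
⊆?-∁ (false ∷ a) (true ∷ b)  (false ∷ x) = ⊆?-∁ a b x
⊆?-∁ (true ∷ a)  (β ∷ b)     (false ∷ x) = refl

count-hat : {v : ℕ} (a b : Subset v) (T : List (Subset v)) →
  count (hatColl T) (a ++ b) ≡ countBy (fits a b) T
count-hat a b T = begin
  count (hatColl T) (a ++ b)                              ≡⟨ count≡countBy (hatColl T) (a ++ b) ⟩
  countBy (λ y → does ((a ++ b) ⊆? y)) (hatColl T)        ≡⟨ countBy-map _ hat T ⟩
  countBy (λ x → does ((a ++ b) ⊆? (x ++ ∁ x))) T         ≡⟨ countBy-ext fits-hat T ⟩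
  countBy (fits a b) T                                    ∎
  where
  open ≡-Reasoning
  fits-hat : ∀ x → does ((a ++ b) ⊆? (x ++ ∁ x)) ≡ fits a b x
  fits-hat x = trans (⊆?-++ a x b (∁ x)) (⊆?-∁ a b x)

fits-⊥ : {n : ℕ} (a x : Subset n) → fits a ⊥ x ≡ does (a ⊆? x)
fits-⊥ []          []          = refl
fits-⊥ (false ∷ a) (true ∷ x)  = fits-⊥ a x
fits-⊥ (true ∷ a)  (true ∷ x)  = fits-⊥ a x
fits-⊥ (false ∷ a) (false ∷ x) = fits-⊥ a x
fits-⊥ (true ∷ a)  (false ∷ x) = refl

indicator-∧ : (h f g k : Bool) → indicator f ≡ indicator g + indicator k →
  indicator (h ∧ f) ≡ indicator (h ∧ g) + indicator (h ∧ k)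
indicator-∧ true  f g k split = split
indicator-∧ false f g k split = refl

-- Deletion–contraction at a forbidden point i ∈ b: a block that avoids b - i either
-- also avoids i, or contains i, i.e. it then fits (a ∪ {i}, b - i).
fits-delete : {n : ℕ} {i : Fin n} (a b x : Subset n) → i ∈ b →
  indicator (fits a (b - i) x) ≡ indicator (fits a b x) + indicator (fits (a ∪ ⁅ i ⁆) (b - i) x)
fits-delete (α ∷ a) (true ∷ b) (ξ ∷ x) here = at-head α ξ (p─⊥≡p b) (∪-identityʳ a)
  where
  at-head : {n : ℕ} (α ξ : Bool) {a a′ b b′ x : Subset n} → b′ ≡ b → a′ ≡ a →
    indicator (admits α false ξ ∧ fits a b′ x)
      ≡ indicator (admits α true ξ ∧ fits a b x) + indicator (admits (α ∨ true) false ξ ∧ fits a′ b′ x)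
  at-head α     true  refl refl = refl
  at-head true  false refl refl = refl
  at-head false false {a} {x = x} refl refl = sym (+-identityʳ (indicator (fits a _ x)))
fits-delete (α ∷ a) (β ∷ b) (ξ ∷ x) (there i∈b)
  rewrite ∨-identityʳ α = indicator-∧ (admits α β ξ) _ _ _ (fits-delete a b x i∈b)

∣p∪q∣≤∣p∣+∣q∣ : {n : ℕ} (p q : Subset n) → ∣ p ∪ q ∣ ≤ ∣ p ∣ + ∣ q ∣
∣p∪q∣≤∣p∣+∣q∣ []          []          = z≤n
∣p∪q∣≤∣p∣+∣q∣ (false ∷ p) (false ∷ q) = ∣p∪q∣≤∣p∣+∣q∣ p q
∣p∪q∣≤∣p∣+∣q∣ (true ∷ p)  (β ∷ q)     = s≤s (≤-trans (∣p∪q∣≤∣p∣+∣q∣ p q) (+-monoʳ-≤ (∣ p ∣) (∣p∣≤∣x∷p∣ β q)))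
∣p∪q∣≤∣p∣+∣q∣ (false ∷ p) (true ∷ q)  =
  subst (suc ∣ p ∪ q ∣ ≤_) (sym (+-suc ∣ p ∣ ∣ q ∣)) (s≤s (∣p∪q∣≤∣p∣+∣q∣ p q))

∣p++q∣ : {n k : ℕ} (p : Subset n) (q : Subset k) → ∣ p ++ q ∣ ≡ ∣ p ∣ + ∣ q ∣
∣p++q∣ []          q = refl
∣p++q∣ (true ∷ p)  q = cong suc (∣p++q∣ p q)
∣p++q∣ (false ∷ p) q = ∣p++q∣ p q

∣p∣+∣∁p∣≡n : {n : ℕ} (p : Subset n) → ∣ p ∣ + ∣ ∁ p ∣ ≡ n
∣p∣+∣∁p∣≡n p = trans (cong (∣ p ∣ +_) (∣∁p∣≡n∸∣p∣ p)) (m+[n∸m]≡n (∣p∣≤n p))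

contraction-size : {n : ℕ} {i : Fin n} (a b : Subset n) → i ∈ b →
  ∣ a ∪ ⁅ i ⁆ ∣ + ∣ b - i ∣ ≤ ∣ a ∣ + ∣ b ∣
contraction-size {i = i} a b i∈b = begin
  ∣ a ∪ ⁅ i ⁆ ∣ + ∣ b - i ∣         ≤⟨ +-monoˡ-≤ (∣ b - i ∣) (∣p∪q∣≤∣p∣+∣q∣ a ⁅ i ⁆) ⟩
  (∣ a ∣ + ∣ ⁅ i ⁆ ∣) + ∣ b - i ∣   ≡⟨ cong (λ m → (∣ a ∣ + m) + ∣ b - i ∣) (∣⁅x⁆∣≡1 i) ⟩
  (∣ a ∣ + 1) + ∣ b - i ∣          ≡⟨ +-assoc (∣ a ∣) 1 (∣ b - i ∣) ⟩
  ∣ a ∣ + suc ∣ b - i ∣            ≤⟨ +-monoʳ-≤ (∣ a ∣) (x∈p⇒∣p-x∣<∣p∣ i∈b) ⟩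
  ∣ a ∣ + ∣ b ∣                    ∎
  where open ≤-Reasoning

Balanced : {n : ℕ} → ℕ → List (Subset n) → List (Subset n) → Set
Balanced {n} t T₀ T₁ = (s : Subset n) → ∣ s ∣ ≤ t → count T₀ s ≡ count T₁ s

fits-balanced-⊥ : {n t : ℕ} (T₀ T₁ : List (Subset n)) → Balanced t T₀ T₁ →
  (a : Subset n) → ∣ a ∣ ≤ t → countBy (fits a ⊥) T₀ ≡ countBy (fits a ⊥) T₁
fits-balanced-⊥ T₀ T₁ bal a ∣a∣≤t = begin
  countBy (fits a ⊥) T₀              ≡⟨ countBy-ext (fits-⊥ a) T₀ ⟩
  countBy (λ x → does (a ⊆? x)) T₀   ≡⟨ sym (count≡countBy T₀ a) ⟩
  count T₀ a                         ≡⟨ bal a ∣a∣≤t ⟩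
  count T₁ a                         ≡⟨ count≡countBy T₁ a ⟩
  countBy (λ x → does (a ⊆? x)) T₁   ≡⟨ sym (countBy-ext (fits-⊥ a) T₁) ⟩
  countBy (fits a ⊥) T₁              ∎
  where open ≡-Reasoning

fits-balanced-below : {n t : ℕ} (T₀ T₁ : List (Subset n)) → Balanced t T₀ T₁ →
  (k : ℕ) (a b : Subset n) → ∣ b ∣ < k → ∣ a ∣ + ∣ b ∣ ≤ t →
  countBy (fits a b) T₀ ≡ countBy (fits a b) T₁
fits-balanced-below {t = t} T₀ T₁ bal (suc k) a b ∣b∣<k size with nonempty? b
... | no b-empty = subst (λ c → countBy (fits a c) T₀ ≡ countBy (fits a c) T₁)
                        (sym (Empty-unique b-empty)) (fits-balanced-⊥ T₀ T₁ bal a (m+n≤o⇒m≤o (∣ a ∣) size))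
... | yes (i , i∈b) = +-cancelʳ-≡ (countBy (fits a′ b′) T₀) _ _ (begin
    countBy (fits a b) T₀ + countBy (fits a′ b′) T₀  ≡⟨ sym (split T₀) ⟩
    countBy (fits a b′) T₀                           ≡⟨ fits-balanced-below T₀ T₁ bal k a b′ shrink size-deleted ⟩
    countBy (fits a b′) T₁                           ≡⟨ split T₁ ⟩
    countBy (fits a b) T₁ + countBy (fits a′ b′) T₁  ≡⟨ cong (_ +_) (sym contracted) ⟩
    countBy (fits a b) T₁ + countBy (fits a′ b′) T₀  ∎)
  where
  open ≡-Reasoning
  a′ b′ : Subset _
  a′ = a ∪ ⁅ i ⁆
  b′ = b - i
  split : ∀ T → countBy (fits a b′) T ≡ countBy (fits a b) T + countBy (fits a′ b′) T
  split = countBy-additive (λ x → fits-delete a b x i∈b)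
  shrink : ∣ b′ ∣ < k
  shrink = <-≤-trans (x∈p⇒∣p-x∣<∣p∣ i∈b) (s≤s⁻¹ ∣b∣<k)
  size-deleted : ∣ a ∣ + ∣ b′ ∣ ≤ t
  size-deleted = ≤-trans (+-monoʳ-≤ (∣ a ∣) (<⇒≤ (x∈p⇒∣p-x∣<∣p∣ i∈b))) size
  contracted : countBy (fits a′ b′) T₀ ≡ countBy (fits a′ b′) T₁
  contracted = fits-balanced-below T₀ T₁ bal k a′ b′ shrink (≤-trans (contraction-size a b i∈b) size)

fits-balanced : {n t : ℕ} (T₀ T₁ : List (Subset n)) → Balanced t T₀ T₁ →
  (a b : Subset n) → ∣ a ∣ + ∣ b ∣ ≤ t → countBy (fits a b) T₀ ≡ countBy (fits a b) T₁
fits-balanced T₀ T₁ bal a b = fits-balanced-below T₀ T₁ bal (suc ∣ b ∣) a b ≤-refl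

hat-balanced : {v t : ℕ} (T₀ T₁ : List (Subset v)) → Balanced t T₀ T₁ →
  Balanced t (hatColl T₀) (hatColl T₁)
hat-balanced {v} {t} T₀ T₁ bal s ∣s∣≤t with splitAt v s
... | a , b , refl = begin
  count (hatColl T₀) (a ++ b)  ≡⟨ count-hat a b T₀ ⟩
  countBy (fits a b) T₀        ≡⟨ fits-balanced T₀ T₁ bal a b (subst (_≤ t) (∣p++q∣ a b) ∣s∣≤t) ⟩
  countBy (fits a b) T₁        ≡⟨ sym (count-hat a b T₁) ⟩
  count (hatColl T₁) (a ++ b)  ∎
  where open ≡-Reasoning

hat-uniform : {v : ℕ} (T : List (Subset v)) → Uniform v (hatColl T)
hat-uniform T b∈hatT with ∈-map⁻ hat b∈hatT
... | x , _ , refl = trans (∣p++q∣ x (∁ x)) (∣p∣+∣∁p∣≡n x)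

map-Disjoint : {A B : Set} {xs ys : List A} (f : A → B) → (∀ {x y} → f x ≡ f y → x ≡ y) →
  Disjoint xs ys → Disjoint (List.map f xs) (List.map f ys)
map-Disjoint f injective disjoint (∈fxs , ∈fys) with ∈-map⁻ f ∈fxs | ∈-map⁻ f ∈fys
... | x , x∈xs , refl | y , y∈ys , fx≡fy with injective fx≡fy
...   | refl = disjoint (x∈xs , y∈ys)

hat-injective : {v : ℕ} {x y : Subset v} → hat x ≡ hat y → x ≡ y
hat-injective {x = x} {y} = ++-injectiveˡ x y

corollary2 : (v t : ℕ) (T₀ T₁ : List (Subset v)) → IsTrade t v T₀ T₁ →
    Uniform v (hatColl T₀) × Uniform v (hatColl T₁) × IsTrade t (v + v) (hatColl T₀) (hatColl T₁)
corollary2 v t T₀ T₁ (disjoint , balanced) =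
  hat-uniform T₀ , hat-uniform T₁ ,
  map-Disjoint hat hat-injective disjoint , hat-balanced T₀ T₁ balanced
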